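{- Let $p\geq3$ be a prime and $1\leq i\leq p-1$ an integer. Then $$\sum_{m=p+1}^{i+p}(-1)^{m-1}(m-1)!\left\{{i+p\atop m}\right\}_{\leq p-1}\equiv\begin{cases}p\pmod{p^2},& i=1,\\ 0\pmod{p^2},& i\geq2.\end{cases}$$
   Context: For integers $n\geq k\geq0$ and $r\geq1$, $\left\{{n\atop k}\right\}_{\leq r}$ denotes the $r$-restricted Stirling number of the second kind: the number of partitions of an $n$-element set into $k$ nonempty blocks each of size at most $r$; equivalently $\frac{1}{k!}\left(\sum_{m=1}^r\frac{t^m}{m!}\right)^k=\sum_{n\geq k}\left\{{n\atop k}\right\}_{\leq r}\frac{t^n}{n!}$. -}

module Defs where

open import Data.Nat using (ℕ; zero; suc; _+_; _*_; _∸_; _≤_; _≤?_; _/_)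
open import Data.Nat using (_!)
open import Data.Nat.Properties using (_!≢0)
open import Data.Fin using (Fin; zero; suc)
open import Data.Fin.Properties using (_≟_)
open import Data.List using (List; []; _∷_; map; concatMap; length; filter; allFin; sum; upTo)
open import Data.List.Relation.Unary.All using (all?)
open import Data.Bool using (Bool; true; false; _∧_)
open import Relation.Nullary.Decidable using (⌊_⌋)
open import Data.Integer as ℤ using (ℤ; +_)

-- All functions Fin n → Fin k, as lists of values (index j ↦ value of element j).
allFuns : (n k : ℕ) → List (List (Fin k))
allFuns zero    k = [] ∷ []
allFuns (suc n) k = concatMap (λ f → map (λ x → x ∷ f) (allFin k)) (allFuns n k)

fibre : {k : ℕ} → Fin k → List (Fin k) → ℕ
fibre b f = length (filter (λ x → x ≟ b) f)

okFun : (r : ℕ) {k : ℕ} → List (Fin k) → Bool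
okFun r {k} f = ⌊ all? (λ b → 1 ≤? fibre b f) (allFin k) ⌋ ∧ ⌊ all? (λ b → fibre b f ≤? r) (allFin k) ⌋

-- number of ordered partitions of an n-set into k labelled nonempty blocks of size ≤ r
orderedCount : (r n k : ℕ) → ℕ
orderedCount r n k = length (filter (λ f → okFun r f Data.Bool.≟ true) (allFuns n k))

-- r-restricted Stirling number of the second kind {n k}_{≤ r}:
-- partitions of an n-set into k nonempty blocks of size ≤ r
-- (= ordered partitions / k!, the blocks being distinct when nonempty).
S≤ : (r n k : ℕ) → ℕ
S≤ r n k = (orderedCount r n k / (k !)) {{k !≢0}}

sgn : ℕ → ℤ
sgn zero = + 1
sgn (suc e) = ℤ.- sgn e

sumFromTo : ℕ → ℕ → (ℕ → ℤ) → ℤ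
sumFromTo a b f = Data.List.foldr ℤ._+_ (+ 0) (map (λ j → f (a + j)) (upTo (suc b ∸ a)))

lhs : (p i : ℕ) → ℤ
lhs p i = sumFromTo (suc p) (i + p)
  (λ m → sgn (m ∸ 1) ℤ.* (+ ((m ∸ 1) !)) ℤ.* (+ S≤ (p ∸ 1) (i + p) m))

{-# OPTIONS --safe #-}
module Submission where

-- If n < k + r, no block of a partition of an n-set into k blocks has more than
-- n - k + 1 ≤ r elements, so the restricted Stirling numbers in the sum are ordinary ones,
-- which we compute by counting surjections: there are k! S(n, k) of them.  By the recurrence
-- S(n+1, m+1) = (m+1) S(n, m+1) + S(n, m) the alternating sum telescopes to
-- (-1)^p p! S(i-1+p, p) = -p (p-1)! S(i-1+p, p), so it suffices that (p-1)! S(i-1+p, p) is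
-- ≡ -1 mod p for i = 1 (where S(p, p) = 1) and ≡ 0 mod p for i ≥ 2.
-- Modulo p, k! S(n, k) is the k-th finite difference of y ↦ y^n at 0, and since
-- C(p-1, j) ≡ (-1)^j the (p-1)-th difference is a plain sum: (p-1)! S(n, p-1) ≡ Σ_{j<p} j^n.
-- With Fermat's little theorem this yields Wilson's theorem and the periodicity
-- (p-1)! S(n+p-1, p-1) ≡ (p-1)! S(n, p-1) for n ≥ 1; hence for i ≥ 2, by the recurrence,
-- (p-1)! S(i-1+p, p) ≡ (p-1)! S(i-2+p, p-1) ≡ (p-1)! S(i-1, p-1) = 0.

open import Defs

module Surjections where

  open import Data.Nat hiding (_≟_)
  open import Data.Nat.Properties hiding (_≟_)
  open import Data.Nat.DivMod using (m*n/n≡m; /-congˡ)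
  open import Data.Nat.ListAction using (sum)
  open import Data.Nat.ListAction.Properties using (sum-++)
  open import Data.Nat.Tactic.RingSolver using (solve-∀)
  open import Data.Bool as Bool using (Bool; true; false)
  open import Data.Bool.Properties using (T-≡)
  open import Data.Fin using (Fin; zero; suc; punchIn; punchOut)
  open import Data.Fin.Properties
    using (_≟_; punchInᵢ≢i; punchOut-cong; punchOut-punchIn; punchIn-punchOut)
  open import Data.List
    using (List; []; _∷_; _++_; map; concatMap; length; filter; allFin; tabulate)
  open import Data.List.Properties
    using (map-++; map-cong; map-tabulate; filter-accept; filter-reject)
  open import Data.List.Membership.Propositional.Properties using (∈-allFin)
  open import Data.List.Relation.Unary.All as All using (all?)
  open import Algebra.Properties.CommutativeMonoid.Sum +-0-commutativeMonoid
    using (sum-syntax; sum-cong-≗; sum-remove; ∑-distrib-+; sum-replicate-zero)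
  open import Algebra.Properties.CommutativeSemigroup +-commutativeSemigroup
    using () renaming (interchange to +-interchange)
  open import Function using (_∘_; Equivalence)
  open import Relation.Nullary using (¬_; Dec; yes; no; contradiction)
  open import Relation.Nullary.Decidable using (⌊_⌋; toWitness; fromWitness)
  open import Relation.Binary.PropositionalEquality

  private
    variable
      A B : Set
      k m n r : ℕ

  stirling : ℕ → ℕ → ℕ
  stirling zero    zero    = 1
  stirling zero    (suc k) = 0
  stirling (suc n) zero    = 0
  stirling (suc n) (suc k) = suc k * stirling n (suc k) + stirling n k

  stirling-< : ∀ n k → n < k → stirling n k ≡ 0
  stirling-< zero    (suc k) _         = refl
  stirling-< (suc n) (suc k) (s≤s n<k) = cong₂ _+_
    (trans (cong (suc k *_) (stirling-< n (suc k) (m≤n⇒m≤1+n n<k))) (*-zeroʳ (suc k)))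
    (stirling-< n k n<k)

  stirling-diag : ∀ n → stirling n n ≡ 1
  stirling-diag zero    = refl
  stirling-diag (suc n) = cong₂ _+_
    (trans (cong (suc n *_) (stirling-< n (suc n) (n<1+n n))) (*-zeroʳ (suc n)))
    (stirling-diag n)

  k!*stirling-suc : ∀ n k → suc k ! * stirling (suc n) (suc k) ≡
                            suc k * (k ! * stirling n k + suc k ! * stirling n (suc k))
  k!*stirling-suc n k = regroup (suc k) (k !) (stirling n k) (stirling n (suc k))
    where
    regroup : ∀ a f s t → (a * f) * (a * t + s) ≡ a * (f * s + (a * f) * t)
    regroup = solve-∀

  sum-map-concatMap : (w : B → ℕ) (g : A → List B) (xs : List A) →
    sum (map w (concatMap g xs)) ≡ sum (map (λ x → sum (map w (g x))) xs)
  sum-map-concatMap w g []       = refl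
  sum-map-concatMap w g (x ∷ xs) = begin
    sum (map w (g x ++ concatMap g xs))                  ≡⟨ cong sum (map-++ w (g x) _) ⟩
    sum (map w (g x) ++ map w (concatMap g xs))          ≡⟨ sum-++ (map w (g x)) _ ⟩
    sum (map w (g x)) + sum (map w (concatMap g xs))
      ≡⟨ cong (sum (map w (g x)) +_) (sum-map-concatMap w g xs) ⟩
    sum (map w (g x)) + sum (map (λ x → sum (map w (g x))) xs) ∎
    where open ≡-Reasoning

  sum-map-tabulate : (w : A → ℕ) (g : Fin k → A) →
    sum (map w (tabulate g)) ≡ ∑[ x < k ] w (g x)
  sum-map-tabulate {k = zero}  w g = refl
  sum-map-tabulate {k = suc k} w g = cong (w (g zero) +_) (sum-map-tabulate w (g ∘ suc))

  sum-map-∑ : (w : Fin k → A → ℕ) (xs : List A) →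
    sum (map (λ a → ∑[ x < k ] w x a) xs) ≡ ∑[ x < k ] sum (map (w x) xs)
  sum-map-∑ {k = k} w []       = sym (sum-replicate-zero k)
  sum-map-∑         w (a ∷ xs) = trans (cong (_ +_) (sum-map-∑ w xs))
    (sym (∑-distrib-+ (λ x → w x a) (λ x → sum (map (w x) xs))))

  sum-map-+ : (u v : A → ℕ) (xs : List A) →
    sum (map (λ a → u a + v a) xs) ≡ sum (map u xs) + sum (map v xs)
  sum-map-+ u v []       = refl
  sum-map-+ u v (a ∷ xs) = trans (cong (u a + v a +_) (sum-map-+ u v xs))
    (+-interchange (u a) (v a) _ _)

  sum-map-zero : (xs : List A) → sum (map (λ _ → 0) xs) ≡ 0
  sum-map-zero []       = refl
  sum-map-zero (_ ∷ xs) = sum-map-zero xs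

  ∑-const : ∀ k c → ∑[ x < k ] c ≡ k * c
  ∑-const zero    c = refl
  ∑-const (suc k) c = cong (c +_) (∑-const k c)

  ∑-funs : (n k : ℕ) → (List (Fin k) → ℕ) → ℕ
  ∑-funs n k w = sum (map w (allFuns n k))

  ∑-funs-suc : ∀ n k (w : List (Fin k) → ℕ) →
    ∑-funs (suc n) k w ≡ ∑[ x < k ] ∑-funs n k (λ f → w (x ∷ f))
  ∑-funs-suc n k w = begin
    sum (map w (concatMap (λ f → map (_∷ f) (allFin k)) (allFuns n k)))
      ≡⟨ sum-map-concatMap w _ (allFuns n k) ⟩
    sum (map (λ f → sum (map w (map (_∷ f) (allFin k)))) (allFuns n k))
      ≡⟨ cong sum (map-cong inner (allFuns n k)) ⟩
    sum (map (λ f → ∑[ x < k ] w (x ∷ f)) (allFuns n k))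
      ≡⟨ sum-map-∑ (λ x f → w (x ∷ f)) (allFuns n k) ⟩
    ∑[ x < k ] ∑-funs n k (λ f → w (x ∷ f)) ∎
    where
    open ≡-Reasoning
    inner : ∀ f → sum (map w (map (_∷ f) (allFin k))) ≡ ∑[ x < k ] w (x ∷ f)
    inner f = trans (cong (sum ∘ map w) (map-tabulate (λ x → x) (_∷ f))) (sum-map-tabulate w (_∷ f))

  ∑-funs-cong : ∀ n k {u v : List (Fin k) → ℕ} → (∀ f → length f ≡ n → u f ≡ v f) →
    ∑-funs n k u ≡ ∑-funs n k v
  ∑-funs-cong zero    k u≗v = cong (_+ 0) (u≗v [] refl)
  ∑-funs-cong (suc n) k {u} {v} u≗v = begin
    ∑-funs (suc n) k u                         ≡⟨ ∑-funs-suc n k u ⟩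
    ∑[ x < k ] ∑-funs n k (λ f → u (x ∷ f))
      ≡⟨ sum-cong-≗ (λ x → ∑-funs-cong n k (λ f len → u≗v (x ∷ f) (cong suc len))) ⟩
    ∑[ x < k ] ∑-funs n k (λ f → v (x ∷ f))    ≡⟨ ∑-funs-suc n k v ⟨
    ∑-funs (suc n) k v                         ∎
    where open ≡-Reasoning

  strip : Fin (suc k) → List (Fin (suc k)) → List (Fin k)
  strip x []      = []
  strip x (y ∷ l) with x ≟ y
  ... | yes _   = strip x l
  ... | no x≢y  = punchOut x≢y ∷ strip x l

  module _ {k : ℕ} where

    fibre-∷-≡ : ∀ {b y : Fin k} {l} → y ≡ b → fibre b (y ∷ l) ≡ suc (fibre b l)
    fibre-∷-≡ {b} y≡b = cong length (filter-accept (_≟ b) y≡b)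

    fibre-∷-≢ : ∀ {b y : Fin k} {l} → y ≢ b → fibre b (y ∷ l) ≡ fibre b l
    fibre-∷-≢ {b} y≢b = cong length (filter-reject (_≟ b) y≢b)

  module _ {k : ℕ} (x : Fin (suc k)) where

    strip-self : ∀ l → strip x (x ∷ l) ≡ strip x l
    strip-self l with x ≟ x
    ... | yes _   = refl
    ... | no x≢x  = contradiction refl x≢x

    strip-punchIn : ∀ b l → strip x (punchIn x b ∷ l) ≡ b ∷ strip x l
    strip-punchIn b l with x ≟ punchIn x b
    ... | yes x≡ = contradiction (sym x≡) (punchInᵢ≢i x b)
    ... | no _   = cong (_∷ strip x l) (trans (punchOut-cong x refl) (punchOut-punchIn x))

    fibre-punchIn : ∀ b l → fibre (punchIn x b) l ≡ fibre b (strip x l)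
    fibre-punchIn b []      = refl
    fibre-punchIn b (y ∷ l) with x ≟ y
    ... | yes refl = trans (fibre-∷-≢ (punchInᵢ≢i x b ∘ sym)) (fibre-punchIn b l)
    ... | no x≢y   = fibre-punchIn-∷ (y ≟ punchIn x b)
      where
      fibre-punchIn-∷ : Dec (y ≡ punchIn x b) →
        fibre (punchIn x b) (y ∷ l) ≡ fibre b (punchOut x≢y ∷ strip x l)
      fibre-punchIn-∷ (yes y≡) = trans (fibre-∷-≡ y≡) (trans (cong suc (fibre-punchIn b l))
        (sym (fibre-∷-≡ (trans (punchOut-cong x y≡) (punchOut-punchIn x)))))
      fibre-punchIn-∷ (no y≢)  = trans (fibre-∷-≢ y≢) (trans (fibre-punchIn b l)
        (sym (fibre-∷-≢ (λ eq → y≢ (trans (sym (punchIn-punchOut x≢y)) (cong (punchIn x) eq))))))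

    fibre+length-strip : ∀ l → fibre x l + length (strip x l) ≡ length l
    fibre+length-strip []      = refl
    fibre+length-strip (y ∷ l) with x ≟ y
    ... | yes refl = trans (cong (_+ length (strip x l)) (fibre-∷-≡ {b = x} {l = l} refl))
                       (cong suc (fibre+length-strip l))
    ... | no x≢y   = trans (cong (_+ _) (fibre-∷-≢ (x≢y ∘ sym)))
                       (trans (+-suc (fibre x l) _) (cong suc (fibre+length-strip l)))

  Onto : List (Fin k) → Set
  Onto f = ∀ b → 1 ≤ fibre b f

  isOnto : List (Fin k) → Bool
  isOnto {k} f = ⌊ all? (λ b → 1 ≤? fibre b f) (allFin k) ⌋

  isOnto⇒Onto : {f : List (Fin k)} → isOnto f ≡ true → Onto f
  isOnto⇒Onto eq b = All.lookup (toWitness (Equivalence.from T-≡ eq)) (∈-allFin b)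

  Onto⇒isOnto : {f : List (Fin k)} → Onto f → isOnto f ≡ true
  Onto⇒isOnto onto = Equivalence.to T-≡ (fromWitness (All.tabulate (λ {b} _ → onto b)))

  ¬Onto⇒isOnto≡false : {f : List (Fin k)} → ¬ Onto f → isOnto f ≡ false
  ¬Onto⇒isOnto≡false {f = f} ¬onto with isOnto f in eq
  ... | true  = contradiction (isOnto⇒Onto {f = f} eq) ¬onto
  ... | false = refl

  isOnto-cong : {f : List (Fin k)} {g : List (Fin m)} →
    (Onto f → Onto g) → (Onto g → Onto f) → isOnto f ≡ isOnto g
  isOnto-cong {f = f} {g} f⇒g g⇒f with isOnto f in eqf | isOnto g in eqg
  ... | true  | true  = refl
  ... | false | false = refl
  ... | true  | false = trans (sym (Onto⇒isOnto {f = g} (f⇒g (isOnto⇒Onto {f = f} eqf)))) eqg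
  ... | false | true  = trans (sym eqf) (Onto⇒isOnto {f = f} (g⇒f (isOnto⇒Onto {f = g} eqg)))

  module _ {k : ℕ} (x : Fin (suc k)) (l : List (Fin (suc k))) where

    Onto-strip : Onto l → Onto (strip x l)
    Onto-strip onto b = subst (1 ≤_) (fibre-punchIn x b l) (onto (punchIn x b))

    Onto-strip-∷ : Onto (strip x l) → Onto (x ∷ l)
    Onto-strip-∷ onto b with x ≟ b
    ... | yes refl = s≤s z≤n
    ... | no x≢b   = subst (1 ≤_)
      (trans (sym (fibre-punchIn x _ l)) (cong (λ c → fibre c l) (punchIn-punchOut x≢b)))
      (onto (punchOut x≢b))

    Onto-∷-present : 1 ≤ fibre x l → Onto (x ∷ l) → Onto l
    Onto-∷-present x∈l onto b with x ≟ b | onto b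
    ... | yes refl | _     = x∈l
    ... | no _     | 1≤fib = 1≤fib

    Onto-∷ : Onto l → Onto (x ∷ l)
    Onto-∷ onto b with x ≟ b
    ... | yes refl = s≤s z≤n
    ... | no _     = onto b

  𝟙 : Bool → ℕ
  𝟙 true  = 1
  𝟙 false = 0

  𝟙-isOnto-∷ : (x : Fin (suc k)) (l : List (Fin (suc k))) →
    𝟙 (isOnto (x ∷ l)) ≡ 𝟙 (fibre x l ≡ᵇ 0) * 𝟙 (isOnto (strip x l)) + 𝟙 (isOnto l)
  𝟙-isOnto-∷ x l with fibre x l in x∉l
  ... | zero = begin
    𝟙 (isOnto (x ∷ l))
      ≡⟨ cong 𝟙 (isOnto-cong {f = x ∷ l} {g = strip x l} ⇒strip ⇐strip) ⟩
    𝟙 (isOnto (strip x l))                        ≡⟨ +-identityʳ _ ⟨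
    𝟙 (isOnto (strip x l)) + 0
      ≡⟨ cong₂ (λ a b → a + 𝟙 b) (*-identityˡ _) l-not-onto ⟨
    1 * 𝟙 (isOnto (strip x l)) + 𝟙 (isOnto l)     ∎
    where
    open ≡-Reasoning
    ⇒strip : Onto (x ∷ l) → Onto (strip x l)
    ⇒strip = subst Onto (strip-self x l) ∘ Onto-strip x (x ∷ l)
    ⇐strip : Onto (strip x l) → Onto (x ∷ l)
    ⇐strip = Onto-strip-∷ x l
    l-not-onto : isOnto l ≡ false
    l-not-onto = ¬Onto⇒isOnto≡false {f = l} (λ onto → n≮0 (subst (1 ≤_) x∉l (onto x)))
  ... | suc _ = cong 𝟙 (isOnto-cong {f = x ∷ l} {g = l}
    (Onto-∷-present x l (subst (1 ≤_) (sym x∉l) (s≤s z≤n))) (Onto-∷ x l))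

  ∑-funs-strip : ∀ n {k} (x : Fin (suc k)) (w : List (Fin k) → ℕ) →
    ∑-funs n (suc k) (λ l → 𝟙 (fibre x l ≡ᵇ 0) * w (strip x l)) ≡ ∑-funs n k w
  ∑-funs-strip zero        x w = cong (_+ 0) (*-identityˡ (w []))
  ∑-funs-strip (suc n) {k} x w = begin
    ∑-funs (suc n) (suc k) W
      ≡⟨ ∑-funs-suc n (suc k) W ⟩
    ∑[ y < suc k ] ∑-funs n (suc k) (λ l → W (y ∷ l))
      ≡⟨ sum-remove {i = x} (λ y → ∑-funs n (suc k) (λ l → W (y ∷ l))) ⟩
    ∑-funs n (suc k) (λ l → W (x ∷ l))
      + ∑[ b < k ] ∑-funs n (suc k) (λ l → W (punchIn x b ∷ l))
      ≡⟨ cong₂ _+_ x-absent (sum-cong-≗ punchIn-present) ⟩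
    ∑[ b < k ] ∑-funs n k (λ g → w (b ∷ g))
      ≡⟨ ∑-funs-suc n k w ⟨
    ∑-funs (suc n) k w ∎
    where
    open ≡-Reasoning
    W : List (Fin (suc k)) → ℕ
    W l = 𝟙 (fibre x l ≡ᵇ 0) * w (strip x l)
    x-absent : ∑-funs n (suc k) (λ l → W (x ∷ l)) ≡ 0
    x-absent = trans
      (∑-funs-cong n (suc k) (λ l _ →
        cong (λ m → 𝟙 (m ≡ᵇ 0) * w (strip x (x ∷ l))) (fibre-∷-≡ {b = x} {l = l} refl)))
      (sum-map-zero (allFuns n (suc k)))
    punchIn-present : ∀ b →
      ∑-funs n (suc k) (λ l → W (punchIn x b ∷ l)) ≡ ∑-funs n k (λ g → w (b ∷ g))
    punchIn-present b = trans
      (∑-funs-cong n (suc k) (λ l _ → cong₂ (λ m g → 𝟙 (m ≡ᵇ 0) * w g)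
        (fibre-∷-≢ {l = l} (punchInᵢ≢i x b)) (strip-punchIn x b l)))
      (∑-funs-strip n x (λ g → w (b ∷ g)))

  surjections : ℕ → ℕ → ℕ
  surjections n k = ∑-funs n k (𝟙 ∘ isOnto)

  surjections-suc : ∀ n k →
    surjections (suc n) (suc k) ≡ suc k * (surjections n k + surjections n (suc k))
  surjections-suc n k = begin
    surjections (suc n) (suc k)
      ≡⟨ ∑-funs-suc n (suc k) (𝟙 ∘ isOnto) ⟩
    ∑[ x < suc k ] ∑-funs n (suc k) (λ l → 𝟙 (isOnto (x ∷ l)))
      ≡⟨ sum-cong-≗ split ⟩
    ∑[ x < suc k ] (surjections n k + surjections n (suc k))
      ≡⟨ ∑-const (suc k) _ ⟩
    suc k * (surjections n k + surjections n (suc k)) ∎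
    where
    open ≡-Reasoning
    split : ∀ x →
      ∑-funs n (suc k) (λ l → 𝟙 (isOnto (x ∷ l))) ≡ surjections n k + surjections n (suc k)
    split x = begin
      ∑-funs n (suc k) (λ l → 𝟙 (isOnto (x ∷ l)))
        ≡⟨ ∑-funs-cong n (suc k) (λ l _ → 𝟙-isOnto-∷ x l) ⟩
      ∑-funs n (suc k) (λ l → 𝟙 (fibre x l ≡ᵇ 0) * 𝟙 (isOnto (strip x l)) + 𝟙 (isOnto l))
        ≡⟨ sum-map-+ _ _ (allFuns n (suc k)) ⟩
      ∑-funs n (suc k) (λ l → 𝟙 (fibre x l ≡ᵇ 0) * 𝟙 (isOnto (strip x l)))
        + surjections n (suc k)
        ≡⟨ cong (_+ surjections n (suc k)) (∑-funs-strip n x (𝟙 ∘ isOnto)) ⟩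
      surjections n k + surjections n (suc k) ∎

  surjections≡k!*stirling : ∀ n k → surjections n k ≡ k ! * stirling n k
  surjections≡k!*stirling zero    zero    = refl
  surjections≡k!*stirling zero    (suc k) = sym (*-zeroʳ (suc k !))
  surjections≡k!*stirling (suc n) zero    = ∑-funs-suc n 0 (𝟙 ∘ isOnto)
  surjections≡k!*stirling (suc n) (suc k) = begin
    surjections (suc n) (suc k)
      ≡⟨ surjections-suc n k ⟩
    suc k * (surjections n k + surjections n (suc k))
      ≡⟨ cong₂ (λ a b → suc k * (a + b))
               (surjections≡k!*stirling n k) (surjections≡k!*stirling n (suc k)) ⟩
    suc k * (k ! * stirling n k + suc k ! * stirling n (suc k))
      ≡⟨ k!*stirling-suc n k ⟨
    suc k ! * stirling (suc n) (suc k) ∎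
    where open ≡-Reasoning

  Onto⇒k≤length : (l : List (Fin k)) → Onto l → k ≤ length l
  Onto⇒k≤length {zero}  l onto = z≤n
  Onto⇒k≤length {suc k} l onto = begin
    suc k
      ≤⟨ +-mono-≤ (onto zero) (Onto⇒k≤length (strip zero l) (Onto-strip zero l onto)) ⟩
    fibre zero l + length (strip zero l)    ≡⟨ fibre+length-strip zero l ⟩
    length l                                ∎
    where open ≤-Reasoning

  Onto⇒fibre≤ : (l : List (Fin k)) → Onto l → length l < k + r → ∀ b → fibre b l ≤ r
  Onto⇒fibre≤ {suc k} {r} l onto (s≤s len≤k+r) b = +-cancelʳ-≤ k (fibre b l) r (begin
    fibre b l + k
      ≤⟨ +-monoʳ-≤ (fibre b l) (Onto⇒k≤length (strip b l) (Onto-strip b l onto)) ⟩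
    fibre b l + length (strip b l)       ≡⟨ fibre+length-strip b l ⟩
    length l                             ≤⟨ len≤k+r ⟩
    k + r                                ≡⟨ +-comm k r ⟩
    r + k                                ∎)
    where open ≤-Reasoning

  okFun≡isOnto : (f : List (Fin k)) → length f < k + r → okFun r f ≡ isOnto f
  okFun≡isOnto {r = r} f len< with isOnto f in eq
  ... | false = refl
  ... | true  = Equivalence.to T-≡ (fromWitness (All.tabulate λ {b} _ →
                  Onto⇒fibre≤ f (isOnto⇒Onto {f = f} eq) len< b))

  length-filter-≡true : (b : A → Bool) (xs : List A) →
    length (filter (λ a → b a Bool.≟ true) xs) ≡ sum (map (𝟙 ∘ b) xs)
  length-filter-≡true b []       = refl
  length-filter-≡true b (a ∷ xs) with b a
  ... | true  = cong suc (length-filter-≡true b xs)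
  ... | false = length-filter-≡true b xs

  orderedCount≡surjections : n < k + r → orderedCount r n k ≡ surjections n k
  orderedCount≡surjections {n} {k} {r} n<k+r = trans (length-filter-≡true (okFun r) (allFuns n k))
    (∑-funs-cong n k (λ f len → cong 𝟙 (okFun≡isOnto f (subst (_< k + r) (sym len) n<k+r))))

  S≤≡stirling : n < k + r → S≤ r n k ≡ stirling n k
  S≤≡stirling {n} {k} {r} n<k+r = begin
    S≤ r n k
      ≡⟨ /-congˡ {{k !≢0}} (orderedCount≡surjections n<k+r) ⟩
    (surjections n k / k !) {{k !≢0}}
      ≡⟨ /-congˡ {{k !≢0}} (trans (surjections≡k!*stirling n k) (*-comm (k !) _)) ⟩
    (stirling n k * k ! / k !) {{k !≢0}}
      ≡⟨ m*n/n≡m (stirling n k) (k !) {{k !≢0}} ⟩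
    stirling n k ∎
    where open ≡-Reasoning

module Congruence where

  open import Data.Nat as ℕ using (ℕ)
  import Data.Nat.Properties as ℕ
  import Data.Nat.Divisibility as ℕ
  open import Data.Nat.Primality using (Prime; euclidsLemma)
  open import Data.Integer
  open import Data.Integer.Properties using (abs-*; +-inverseʳ; +-identityʳ; *-comm; pos-*)
  import Data.Integer.Divisibility as Unsigned
  open import Data.Integer.Divisibility.Signed
  open import Data.Integer.Tactic.RingSolver using (solve-∀)
  open import Data.Sum using (inj₁; inj₂)
  open import Relation.Binary.Bundles using (Setoid)
  import Relation.Binary.Reasoning.Setoid
  open import Relation.Binary.PropositionalEquality
  open import Relation.Nullary using (¬_; contradiction)

  infix 4 _≡_mod_

  record _≡_mod_ (a b : ℤ) (m : ℕ) : Set where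
    constructor congruent
    field
      divides-difference : + m ∣ a - b

  private
    variable
      a b c d : ℤ

  module _ {m : ℕ} where

    ≡-mod-refl : a ≡ a mod m
    ≡-mod-refl {a} = congruent (subst (+ m ∣_) (sym (+-inverseʳ a)) (divides 0ℤ refl))

    ≡⇒≡-mod : a ≡ b → a ≡ b mod m
    ≡⇒≡-mod refl = ≡-mod-refl

    ≡-mod-sym : a ≡ b mod m → b ≡ a mod m
    ≡-mod-sym {a} {b} (congruent m∣a-b) =
      congruent (subst (+ m ∣_) (negate-difference a b) (∣m⇒∣-m m∣a-b))
      where
      negate-difference : ∀ a b → - (a - b) ≡ b - a
      negate-difference = solve-∀

    ≡-mod-trans : a ≡ b mod m → b ≡ c mod m → a ≡ c mod m
    ≡-mod-trans {a} {b} {c} (congruent m∣a-b) (congruent m∣b-c) =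
      congruent (subst (+ m ∣_) (add-differences a b c) (∣m∣n⇒∣m+n m∣a-b m∣b-c))
      where
      add-differences : ∀ a b c → (a - b) + (b - c) ≡ a - c
      add-differences = solve-∀

    +-cong-mod : a ≡ b mod m → c ≡ d mod m → a + c ≡ b + d mod m
    +-cong-mod {a} {b} {c} {d} (congruent m∣a-b) (congruent m∣c-d) =
      congruent (subst (+ m ∣_) (add-differences a b c d) (∣m∣n⇒∣m+n m∣a-b m∣c-d))
      where
      add-differences : ∀ a b c d → (a - b) + (c - d) ≡ (a + c) - (b + d)
      add-differences = solve-∀

    -‿cong-mod : a ≡ b mod m → - a ≡ - b mod m
    -‿cong-mod {a} {b} (congruent m∣a-b) =
      congruent (subst (+ m ∣_) (negate-difference a b) (∣m⇒∣-m m∣a-b))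
      where
      negate-difference : ∀ a b → - (a - b) ≡ - a - - b
      negate-difference = solve-∀

    *-congˡ-mod : ∀ c → a ≡ b mod m → c * a ≡ c * b mod m
    *-congˡ-mod {a} {b} c (congruent m∣a-b) =
      congruent (subst (+ m ∣_) (scale-difference c a b) (∣n⇒∣m*n c m∣a-b))
      where
      scale-difference : ∀ c a b → c * (a - b) ≡ c * a - c * b
      scale-difference = solve-∀

    *-congʳ-mod : ∀ c → a ≡ b mod m → a * c ≡ b * c mod m
    *-congʳ-mod {a} {b} c a≡b = subst₂ (_≡_mod m) (*-comm c a) (*-comm c b) (*-congˡ-mod c a≡b)

    ∣⇒≡0-mod : + m ∣ a → a ≡ 0ℤ mod m
    ∣⇒≡0-mod {a} m∣a = congruent (subst (+ m ∣_) (sym (+-identityʳ a)) m∣a)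

    ≡-mod-setoid : Setoid _ _
    ≡-mod-setoid = record
      { Carrier       = ℤ
      ; _≈_           = _≡_mod m
      ; isEquivalence = record { refl = ≡-mod-refl ; sym = ≡-mod-sym ; trans = ≡-mod-trans }
      }

  module ≡-mod-Reasoning (m : ℕ) = Relation.Binary.Reasoning.Setoid (≡-mod-setoid {m})

  cancel-mod : ∀ {p a} → Prime p → ¬ p ℕ.∣ a → + a * b ≡ + a * c mod p → b ≡ c mod p
  cancel-mod {b} {c} {p} {a} p-prime p∤a (congruent p∣ab-ac)
    with euclidsLemma a ∣ b - c ∣ p-prime p∣a∣b-c∣
    where
    factor : ∀ a b c → a * b - a * c ≡ a * (b - c)
    factor = solve-∀
    p∣a∣b-c∣ : p ℕ.∣ a ℕ.* ∣ b - c ∣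
    p∣a∣b-c∣ = subst (p ℕ.∣_) (abs-* (+ a) (b - c))
      (∣⇒∣ᵤ (subst (+ p ∣_) (factor (+ a) b c) p∣ab-ac))
  ... | inj₁ p∣a     = contradiction p∣a p∤a
  ... | inj₂ p∣∣b-c∣ = congruent (∣ᵤ⇒∣ p∣∣b-c∣)

  ≡0-mod⇒m²∣-m*a : ∀ {m a} → a ≡ 0ℤ mod m → + (m ℕ.^ 2) Unsigned.∣ - (+ m * a)
  ≡0-mod⇒m²∣-m*a {m} {a} (congruent (divides t a-0≡t*m)) = ∣⇒∣ᵤ (divides (- t) (begin
    - (+ m * a)              ≡⟨ cong (λ x → - (+ m * x)) (trans (sym (+-identityʳ a)) a-0≡t*m) ⟩
    - (+ m * (t * + m))      ≡⟨ rearrange (+ m) t ⟩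
    - t * (+ m * + m)        ≡⟨ cong (- t *_) m*m≡m² ⟩
    - t * + (m ℕ.^ 2)        ∎))
    where
    open ≡-Reasoning
    rearrange : ∀ m t → - (m * (t * m)) ≡ - t * (m * m)
    rearrange = solve-∀
    m*m≡m² : + m * + m ≡ + (m ℕ.^ 2)
    m*m≡m² = trans (sym (pos-* m m)) (cong (λ k → + (m ℕ.* k)) (sym (ℕ.*-identityʳ m)))

module FiniteDifferences where

  open import Data.Nat as ℕ using (ℕ; zero; suc; _∸_; z≤n; s≤s; _!)
  import Data.Nat.Properties as ℕ
  open import Data.Nat.Combinatorics using (_C_; nCk+nC[k+1]≡[n+1]C[k+1]; k>n⇒nCk≡0)
  open import Data.Integer hiding (suc)
  open import Data.Integer.Properties
  open import Data.Integer.Tactic.RingSolver using (solve-∀)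
  open import Data.List using (map; foldr; applyUpTo)
  open import Function using (_∘_)
  open import Relation.Binary.PropositionalEquality
  open Surjections using (stirling; k!*stirling-suc)
  open Congruence

  sumℤ : ℕ → (ℕ → ℤ) → ℤ
  sumℤ zero    f = 0ℤ
  sumℤ (suc n) f = f 0 + sumℤ n (f ∘ suc)

  sumℤ-cong : ∀ n {f g : ℕ → ℤ} → (∀ j → f j ≡ g j) → sumℤ n f ≡ sumℤ n g
  sumℤ-cong zero    f≗g = refl
  sumℤ-cong (suc n) f≗g = cong₂ _+_ (f≗g 0) (sumℤ-cong n (f≗g ∘ suc))

  sumℤ-+ : ∀ n (f g : ℕ → ℤ) → sumℤ n (λ j → f j + g j) ≡ sumℤ n f + sumℤ n g
  sumℤ-+ zero    f g = refl
  sumℤ-+ (suc n) f g = trans (cong (_+_ (f 0 + g 0)) (sumℤ-+ n (f ∘ suc) (g ∘ suc)))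
    (interchange (f 0) (g 0) _ _)
    where
    interchange : ∀ a b c d → a + b + (c + d) ≡ a + c + (b + d)
    interchange = solve-∀

  sumℤ-neg : ∀ n (f : ℕ → ℤ) → sumℤ n (λ j → - f j) ≡ - sumℤ n f
  sumℤ-neg zero    f = refl
  sumℤ-neg (suc n) f =
    trans (cong (_+_ (- f 0)) (sumℤ-neg n (f ∘ suc))) (sym (neg-distrib-+ (f 0) _))

  sumℤ-last : ∀ n (f : ℕ → ℤ) → sumℤ (suc n) f ≡ sumℤ n f + f n
  sumℤ-last zero    f = trans (+-identityʳ (f 0)) (sym (+-identityˡ (f 0)))
  sumℤ-last (suc n) f = trans (cong (_+_ (f 0)) (sumℤ-last n (f ∘ suc))) (sym (+-assoc (f 0) _ _))

  sumℤ-telescope : ∀ n (g : ℕ → ℤ) → sumℤ n (λ j → g j - g (suc j)) ≡ g 0 - g n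
  sumℤ-telescope zero    g = sym (+-inverseʳ (g 0))
  sumℤ-telescope (suc n) g = trans (cong (_+_ (g 0 - g 1)) (sumℤ-telescope n (g ∘ suc)))
    (chain (g 0) (g 1) (g (suc n)))
    where
    chain : ∀ a b c → a - b + (b - c) ≡ a - c
    chain = solve-∀

  sumℤ-shift : ∀ n (g : ℕ → ℤ) → sumℤ n (g ∘ suc) - sumℤ n g ≡ g n - g 0
  sumℤ-shift zero    g = sym (+-inverseʳ (g 0))
  sumℤ-shift (suc n) g = begin
    (g 1 + sumℤ n (g ∘ suc ∘ suc)) - (g 0 + sumℤ n (g ∘ suc))
      ≡⟨ regroup (g 0) (g 1) (sumℤ n (g ∘ suc ∘ suc)) (sumℤ n (g ∘ suc)) ⟩
    (sumℤ n (g ∘ suc ∘ suc) - sumℤ n (g ∘ suc)) + (g 1 - g 0)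
      ≡⟨ cong (_+ (g 1 - g 0)) (sumℤ-shift n (g ∘ suc)) ⟩
    (g (suc n) - g 1) + (g 1 - g 0)
      ≡⟨ chain (g (suc n)) (g 1) (g 0) ⟩
    g (suc n) - g 0 ∎
    where
    open ≡-Reasoning
    regroup : ∀ a b c d → (b + c) - (a + d) ≡ (c - d) + (b - a)
    regroup = solve-∀
    chain : ∀ a b c → a - b + (b - c) ≡ a - c
    chain = solve-∀

  sumℤ-ones : ∀ n → sumℤ n (λ _ → 1ℤ) ≡ + n
  sumℤ-ones zero    = refl
  sumℤ-ones (suc n) = trans (cong (_+_ 1ℤ) (sumℤ-ones n)) (sym (pos-+ 1 n))

  sumℤ-cong-mod : ∀ {m} n {f g : ℕ → ℤ} →
    (∀ j → j ℕ.< n → f j ≡ g j mod m) → sumℤ n f ≡ sumℤ n g mod m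
  sumℤ-cong-mod zero    f≡g = ≡-mod-refl
  sumℤ-cong-mod (suc n) f≡g =
    +-cong-mod (f≡g 0 (s≤s z≤n)) (sumℤ-cong-mod n (λ j j<n → f≡g (suc j) (s≤s j<n)))

  foldr-map-applyUpTo : ∀ c (g : ℕ → ℤ) (h : ℕ → ℕ) →
    foldr _+_ 0ℤ (map g (applyUpTo h c)) ≡ sumℤ c (g ∘ h)
  foldr-map-applyUpTo zero    g h = refl
  foldr-map-applyUpTo (suc c) g h = cong (_+_ (g (h 0))) (foldr-map-applyUpTo c g (h ∘ suc))

  sumFromTo≡sumℤ : ∀ a b f → sumFromTo a b f ≡ sumℤ (suc b ∸ a) (λ j → f (a ℕ.+ j))
  sumFromTo≡sumℤ a b f = foldr-map-applyUpTo (suc b ∸ a) (λ j → f (a ℕ.+ j)) (λ j → j)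

  Δ : ℕ → (ℕ → ℤ) → ℕ → ℤ
  Δ zero    f x = f x
  Δ (suc k) f x = Δ k f (suc x) - Δ k f x

  pascal-sum : ∀ k (g : ℕ → ℤ) →
    sumℤ (suc (suc k)) (λ j → + (suc k C j) * g j) ≡
    sumℤ (suc k) (λ j → + (k C j) * g j) + sumℤ (suc k) (λ j → + (k C j) * g (suc j))
  pascal-sum k g = begin
    1ℤ * g 0 + sumℤ (suc k) (λ j → + (suc k C suc j) * g (suc j))
      ≡⟨ cong (_+_ (1ℤ * g 0)) (trans (sumℤ-cong (suc k) split-coefficient)
           (sumℤ-+ (suc k) (λ j → + (k C j) * g (suc j)) (λ j → + (k C suc j) * g (suc j)))) ⟩
    1ℤ * g 0 + (B + sumℤ (suc k) (λ j → + (k C suc j) * g (suc j)))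
      ≡⟨ cong (λ t → 1ℤ * g 0 + (B + t)) (sumℤ-last k (λ j → + (k C suc j) * g (suc j))) ⟩
    1ℤ * g 0 + (B + (A + + (k C suc k) * g (suc k)))
      ≡⟨ cong (λ c → 1ℤ * g 0 + (B + (A + + c * g (suc k)))) (k>n⇒nCk≡0 (ℕ.n<1+n k)) ⟩
    1ℤ * g 0 + (B + (A + 0ℤ * g (suc k)))
      ≡⟨ regroup (1ℤ * g 0) B A (g (suc k)) ⟩
    (1ℤ * g 0 + A) + B ∎
    where
    open ≡-Reasoning
    A = sumℤ k (λ j → + (k C suc j) * g (suc j))
    B = sumℤ (suc k) (λ j → + (k C j) * g (suc j))
    split-coefficient : ∀ j →
      + (suc k C suc j) * g (suc j) ≡ + (k C j) * g (suc j) + + (k C suc j) * g (suc j)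
    split-coefficient j = trans (cong (λ c → + c * g (suc j)) (sym (nCk+nC[k+1]≡[n+1]C[k+1] k j)))
      (trans (cong (_* g (suc j)) (pos-+ (k C j) (k C suc j)))
             (*-distribʳ-+ (g (suc j)) (+ (k C j)) (+ (k C suc j))))
    regroup : ∀ a b c d → a + (b + (c + 0ℤ * d)) ≡ (a + c) + b
    regroup = solve-∀

  Δ-binomial : ∀ k (f : ℕ → ℤ) x →
    Δ k f x ≡ sumℤ (suc k) (λ j → + (k C j) * (sgn (k ℕ.+ j) * f (x ℕ.+ j)))
  Δ-binomial zero f x = sym (trans (+-identityʳ _) (trans (*-identityˡ _)
    (trans (*-identityˡ _) (cong f (ℕ.+-identityʳ x)))))
  Δ-binomial (suc k) f x = sym (begin
    sumℤ (suc (suc k)) (λ j → + (suc k C j) * (sgn (suc k ℕ.+ j) * f (x ℕ.+ j)))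
      ≡⟨ pascal-sum k (λ j → sgn (suc k ℕ.+ j) * f (x ℕ.+ j)) ⟩
    sumℤ (suc k) (λ j → + (k C j) * (- sgn (k ℕ.+ j) * f (x ℕ.+ j)))
      + sumℤ (suc k) (λ j → + (k C j) * (sgn (suc k ℕ.+ suc j) * f (x ℕ.+ suc j)))
      ≡⟨ cong₂ _+_ (trans (sumℤ-cong (suc k) pull-sign) (sumℤ-neg (suc k) (term f x)))
                   (sumℤ-cong (suc k) shift-term) ⟩
    - sumℤ (suc k) (term f x) + sumℤ (suc k) (term f (suc x))
      ≡⟨ cong₂ (λ a b → - a + b) (Δ-binomial k f x) (Δ-binomial k f (suc x)) ⟨
    - Δ k f x + Δ k f (suc x)
      ≡⟨ +-comm (- Δ k f x) _ ⟩
    Δ k f (suc x) - Δ k f x ∎)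
    where
    open ≡-Reasoning
    term : (ℕ → ℤ) → ℕ → ℕ → ℤ
    term f x j = + (k C j) * (sgn (k ℕ.+ j) * f (x ℕ.+ j))
    pull-sign : ∀ j → + (k C j) * (- sgn (k ℕ.+ j) * f (x ℕ.+ j)) ≡ - term f x j
    pull-sign j = move-minus (+ (k C j)) (sgn (k ℕ.+ j)) (f (x ℕ.+ j))
      where
      move-minus : ∀ c s v → c * (- s * v) ≡ - (c * (s * v))
      move-minus = solve-∀
    shift-term : ∀ j → + (k C j) * (sgn (suc k ℕ.+ suc j) * f (x ℕ.+ suc j)) ≡ term f (suc x) j
    shift-term j = cong₂ (λ s y → + (k C j) * (s * f y))
      (trans (cong (λ e → - sgn e) (ℕ.+-suc k j)) (neg-involutive (sgn (k ℕ.+ j))))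
      (ℕ.+-suc x j)

  Δ-leibniz : ∀ m (g : ℕ → ℤ) x →
    Δ (suc m) (λ y → + y * g y) x ≡ + x * Δ (suc m) g x + + suc m * Δ m g (suc x)
  Δ-leibniz zero    g x = expand (+ x) (g (suc x)) (g x)
    where
    expand : ∀ X a b → (1ℤ + X) * a - X * b ≡ X * (a - b) + 1ℤ * a
    expand = solve-∀
  Δ-leibniz (suc m) g x = trans (cong₂ _-_ (Δ-leibniz m g (suc x)) (Δ-leibniz m g x))
    (regroup (+ x) (+ m) (Δ m g (suc (suc x))) (Δ m g (suc x)) (Δ (suc m) g x))
    where
    regroup : ∀ X M a b c → ((1ℤ + X) * (a - b) + (1ℤ + M) * a) - (X * c + (1ℤ + M) * b)
                            ≡ X * ((a - b) - c) + (1ℤ + (1ℤ + M)) * (a - b)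
    regroup = solve-∀

  Δ-const : ∀ k c x → Δ (suc k) (λ _ → c) x ≡ 0ℤ
  Δ-const zero    c x = +-inverseʳ c
  Δ-const (suc k) c x = cong₂ _-_ (Δ-const k c (suc x)) (Δ-const k c x)

  Δ-pow : ∀ n k → Δ k (λ y → (+ y) ^ n) 0 ≡ + (k ! ℕ.* stirling n k)
  Δ-pow zero    zero    = refl
  Δ-pow zero    (suc k) = trans (Δ-const k 1ℤ 0) (cong +_ (sym (ℕ.*-zeroʳ (suc k !))))
  Δ-pow (suc n) zero    = refl
  Δ-pow (suc n) (suc k) = begin
    Δ (suc k) (λ y → + y * g y) 0
      ≡⟨ Δ-leibniz k g 0 ⟩
    0ℤ * Δ (suc k) g 0 + + suc k * Δ k g 1
      ≡⟨ regroup (Δ (suc k) g 0) (+ suc k) (Δ k g 1) (Δ k g 0) ⟩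
    + suc k * (Δ k g 0 + Δ (suc k) g 0)
      ≡⟨ cong₂ (λ a b → + suc k * (a + b)) (Δ-pow n k) (Δ-pow n (suc k)) ⟩
    + suc k * (+ (k ! ℕ.* stirling n k) + + (suc k ! ℕ.* stirling n (suc k)))
      ≡⟨ cong (+ suc k *_) (pos-+ (k ! ℕ.* stirling n k) _) ⟨
    + suc k * + (k ! ℕ.* stirling n k ℕ.+ suc k ! ℕ.* stirling n (suc k))
      ≡⟨ pos-* (suc k) _ ⟨
    + (suc k ℕ.* (k ! ℕ.* stirling n k ℕ.+ suc k ! ℕ.* stirling n (suc k)))
      ≡⟨ cong +_ (k!*stirling-suc n k) ⟨
    + (suc k ! ℕ.* stirling (suc n) (suc k)) ∎
    where
    open ≡-Reasoning
    g : ℕ → ℤ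
    g y = (+ y) ^ n
    regroup : ∀ e K a b → 0ℤ * e + K * a ≡ K * (b + (a - b))
    regroup = solve-∀

  Δ-geometric : ∀ k c x → Δ k (λ y → c ^ y) x ≡ (c - 1ℤ) ^ k * c ^ x
  Δ-geometric zero    c x = sym (*-identityˡ (c ^ x))
  Δ-geometric (suc k) c x = trans (cong₂ _-_ (Δ-geometric k c (suc x)) (Δ-geometric k c x))
    (factor ((c - 1ℤ) ^ k) c (c ^ x))
    where
    factor : ∀ d c e → d * (c * e) - d * e ≡ ((c - 1ℤ) * d) * e
    factor = solve-∀

  0^n≡0 : ∀ {n} → 0 ℕ.< n → (+ 0) ^ n ≡ 0ℤ
  0^n≡0 (s≤s z≤n) = refl

module BinomialModPrime where

  open import Data.Nat
  open import Data.Nat.Properties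
  open import Data.Nat.Combinatorics using (_C_; nCk+nC[k+1]≡[n+1]C[k+1]; nC1≡n)
  open import Data.Nat.Divisibility using (_∣_; divides; >⇒∤)
  open import Data.Nat.Primality using (Prime; euclidsLemma)
  open import Data.Sum using (inj₁; inj₂)
  open import Relation.Binary.PropositionalEquality
  open import Relation.Nullary using (contradiction)

  [k+1]*[n+1]C[k+1]≡[n+1]*nCk : ∀ n k → suc k * (suc n C suc k) ≡ suc n * (n C k)
  [k+1]*[n+1]C[k+1]≡[n+1]*nCk zero    zero    = refl
  [k+1]*[n+1]C[k+1]≡[n+1]*nCk zero    (suc k) = *-zeroʳ (suc (suc k))
  [k+1]*[n+1]C[k+1]≡[n+1]*nCk (suc n) zero    =
    trans (+-identityʳ _) (trans (nC1≡n (suc (suc n))) (sym (*-identityʳ _)))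
  [k+1]*[n+1]C[k+1]≡[n+1]*nCk (suc n) (suc k) = begin
    suc (suc k) * (suc (suc n) C suc (suc k))
      ≡⟨ cong (suc (suc k) *_) (nCk+nC[k+1]≡[n+1]C[k+1] (suc n) (suc k)) ⟨
    suc (suc k) * (X + Y)
      ≡⟨ *-distribˡ-+ (suc (suc k)) X Y ⟩
    (X + suc k * X) + suc (suc k) * Y
      ≡⟨ cong₂ (λ a b → (X + a) + b) ([k+1]*[n+1]C[k+1]≡[n+1]*nCk n k)
                                     ([k+1]*[n+1]C[k+1]≡[n+1]*nCk n (suc k)) ⟩
    (X + suc n * (n C k)) + suc n * (n C suc k)
      ≡⟨ +-assoc X _ _ ⟩
    X + (suc n * (n C k) + suc n * (n C suc k))
      ≡⟨ cong (X +_) (*-distribˡ-+ (suc n) (n C k) (n C suc k)) ⟨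
    X + suc n * (n C k + n C suc k)
      ≡⟨ cong (λ c → X + suc n * c) (nCk+nC[k+1]≡[n+1]C[k+1] n k) ⟩
    X + suc n * X ∎
    where
    open ≡-Reasoning
    X = suc n C suc k
    Y = suc n C suc (suc k)

  prime∣pC[k+1] : ∀ {q k} → Prime (suc q) → k < q → suc q ∣ suc q C suc k
  prime∣pC[k+1] {q} {k} p-prime k<q
    with euclidsLemma (suc k) (suc q C suc k) p-prime
           (divides (q C k) (trans ([k+1]*[n+1]C[k+1]≡[n+1]*nCk q k) (*-comm (suc q) (q C k))))
  ... | inj₁ p∣k+1 = contradiction p∣k+1 (>⇒∤ (s≤s k<q))
  ... | inj₂ p∣pCk = p∣pCk

module AlternatingSum where

  open import Data.Nat as ℕ using (ℕ; suc; _≤_; _<_; s≤s; _!; _∸_)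
  import Data.Nat.Properties as ℕ
  open import Data.Integer hiding (suc; _≤_; _<_)
  open import Data.Integer.Properties
  open import Data.Integer.Tactic.RingSolver using (solve-∀)
  open import Relation.Binary.PropositionalEquality
  open Surjections using (stirling; stirling-<; S≤≡stirling)
  open FiniteDifferences using (sumℤ; sumℤ-cong; sumℤ-telescope; sumFromTo≡sumℤ)

  signedStirling : ℕ → ℕ → ℤ
  signedStirling n m = sgn m * + (m ! ℕ.* stirling n m)

  term≡difference : ∀ n m →
    sgn m * + (m !) * + stirling (suc n) (suc m) ≡ signedStirling n m - signedStirling n (suc m)
  term≡difference n m = begin
    sgn m * + (m !) * + (suc m ℕ.* A ℕ.+ B)
      ≡⟨ cong (sgn m * + (m !) *_) (trans (pos-+ (suc m ℕ.* A) B) (cong (_+ + B) (pos-* (suc m) A))) ⟩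
    sgn m * + (m !) * (+ suc m * + A + + B)
      ≡⟨ rearrange (sgn m) (+ (m !)) (+ suc m) (+ A) (+ B) ⟩
    sgn m * (+ (m !) * + B) - - sgn m * ((+ suc m * + (m !)) * + A)
      ≡⟨ cong₂ (λ x y → sgn m * x - - sgn m * y) (pos-* (m !) B)
               (trans (pos-* (suc m !) A) (cong (_* + A) (pos-* (suc m) (m !)))) ⟨
    signedStirling n m - signedStirling n (suc m) ∎
    where
    open ≡-Reasoning
    A B : ℕ
    A = stirling n (suc m)
    B = stirling n m
    rearrange : ∀ s f k a b → s * f * (k * a + b) ≡ s * (f * b) - (- s) * ((k * f) * a)
    rearrange = solve-∀

  alternating-stirling-sum : ∀ n a c →
    sumℤ c (λ j → sgn (a ℕ.+ j) * + ((a ℕ.+ j) !) * + stirling (suc n) (suc (a ℕ.+ j)))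
      ≡ signedStirling n a - signedStirling n (a ℕ.+ c)
  alternating-stirling-sum n a c = begin
    sumℤ c (λ j → sgn (a ℕ.+ j) * + ((a ℕ.+ j) !) * + stirling (suc n) (suc (a ℕ.+ j)))
      ≡⟨ sumℤ-cong c (λ j → trans (term≡difference n (a ℕ.+ j))
           (cong (λ m → signedStirling n (a ℕ.+ j) - signedStirling n m) (sym (ℕ.+-suc a j)))) ⟩
    sumℤ c (λ j → signedStirling n (a ℕ.+ j) - signedStirling n (a ℕ.+ suc j))
      ≡⟨ sumℤ-telescope c (λ j → signedStirling n (a ℕ.+ j)) ⟩
    signedStirling n (a ℕ.+ 0) - signedStirling n (a ℕ.+ c)
      ≡⟨ cong (λ m → signedStirling n m - signedStirling n (a ℕ.+ c)) (ℕ.+-identityʳ a) ⟩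
    signedStirling n a - signedStirling n (a ℕ.+ c) ∎
    where open ≡-Reasoning

  signedStirling-< : ∀ n m → n < m → signedStirling n m ≡ 0ℤ
  signedStirling-< n m n<m = begin
    sgn m * + (m ! ℕ.* stirling n m)   ≡⟨ cong (λ s → sgn m * + (m ! ℕ.* s)) (stirling-< _ _ n<m) ⟩
    sgn m * + (m ! ℕ.* 0)              ≡⟨ cong (λ x → sgn m * + x) (ℕ.*-zeroʳ (m !)) ⟩
    sgn m * 0ℤ                         ≡⟨ *-zeroʳ (sgn m) ⟩
    0ℤ                                 ∎
    where open ≡-Reasoning

  lhs-closed-form : ∀ q i → suc i ≤ q → lhs (suc q) (suc i) ≡ signedStirling (i ℕ.+ suc q) (suc q)
  lhs-closed-form q i i<q = begin
    lhs p (suc i)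
      ≡⟨ sumFromTo≡sumℤ (suc p) (suc i ℕ.+ p) F ⟩
    sumℤ (suc i ℕ.+ p ∸ p) (λ j → F (suc p ℕ.+ j))
      ≡⟨ cong (λ c → sumℤ c (λ j → F (suc p ℕ.+ j))) (ℕ.m+n∸n≡m (suc i) p) ⟩
    sumℤ (suc i) (λ j → F (suc p ℕ.+ j))
      ≡⟨ sumℤ-cong (suc i) (λ j → cong (term j) (unrestricted j)) ⟩
    sumℤ (suc i) (λ j → term j (stirling (suc i ℕ.+ p) (suc (p ℕ.+ j))))
      ≡⟨ alternating-stirling-sum (i ℕ.+ p) p (suc i) ⟩
    signedStirling (i ℕ.+ p) p - signedStirling (i ℕ.+ p) (p ℕ.+ suc i)
      ≡⟨ cong (_-_ (signedStirling (i ℕ.+ p) p))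
              (signedStirling-< (i ℕ.+ p) (p ℕ.+ suc i) i+p<p+i+1) ⟩
    signedStirling (i ℕ.+ p) p - 0ℤ
      ≡⟨ +-identityʳ _ ⟩
    signedStirling (i ℕ.+ p) p ∎
    where
    open ≡-Reasoning
    p : ℕ
    p = suc q
    F : ℕ → ℤ
    F m = sgn (m ∸ 1) * + ((m ∸ 1) !) * + S≤ (p ∸ 1) (suc i ℕ.+ p) m
    term : ℕ → ℕ → ℤ
    term j s = sgn (p ℕ.+ j) * + ((p ℕ.+ j) !) * + s
    unrestricted : ∀ j →
      S≤ q (suc i ℕ.+ p) (suc (p ℕ.+ j)) ≡ stirling (suc i ℕ.+ p) (suc (p ℕ.+ j))
    unrestricted j = S≤≡stirling (s≤s (ℕ.≤-trans (ℕ.+-monoˡ-≤ p i<q)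
      (ℕ.≤-trans (ℕ.≤-reflexive (ℕ.+-comm q p)) (ℕ.+-monoˡ-≤ q (ℕ.m≤m+n p j)))))
    i+p<p+i+1 : i ℕ.+ p < p ℕ.+ suc i
    i+p<p+i+1 = ℕ.≤-reflexive (trans (cong suc (ℕ.+-comm i p)) (sym (ℕ.+-suc p i)))

open import Data.Nat.Base using (ℕ; suc)
open import Data.Nat.Primality using (Prime)
open import Data.Integer.Base using (1ℤ)
open import Relation.Binary.PropositionalEquality using (_≡_)

-- p = suc q is an odd prime; q-even says that q = p - 1 is even.
module OddPrime {q : ℕ} (p-prime : Prime (suc q)) (q-even : sgn q ≡ 1ℤ) where

  open import Data.Nat as ℕ using (zero; s≤s; _!)
  import Data.Nat.Properties as ℕ
  open import Data.Nat.Divisibility using (>⇒∤)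
  open import Data.Nat.Primality using (prime⇒nonTrivial)
  open import Data.Nat.Combinatorics using (_C_; nCk+nC[k+1]≡[n+1]C[k+1])
  import Data.Nat.Tactic.RingSolver as ℕ-Solver
  open import Data.Integer hiding (suc)
  open import Data.Integer.Properties
  import Data.Integer.Divisibility as Unsigned
  open import Data.Integer.Divisibility.Signed using (divides; ∣ᵤ⇒∣)
  open import Data.Integer.Tactic.RingSolver using (solve-∀)
  open import Function using (_∘_)
  open import Relation.Binary.PropositionalEquality
  open Surjections using (stirling; stirling-<; stirling-diag)
  open Congruence
  open FiniteDifferences
  open BinomialModPrime
  open AlternatingSum using (signedStirling; lhs-closed-form)

  p : ℕ
  p = suc q

  q≥1 : 1 ℕ.≤ q
  q≥1 = ℕ.≤-pred (ℕ.nonTrivial⇒n>1 p {{prime⇒nonTrivial p-prime}})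

  signedStirling[n,p] : ∀ n → signedStirling n p ≡ - (+ p * + (q ! ℕ.* stirling n p))
  signedStirling[n,p] n = begin
    - sgn q * + (p ! ℕ.* stirling n p)   ≡⟨ cong (λ s → - s * + (p ! ℕ.* stirling n p)) q-even ⟩
    -1ℤ * + (p ! ℕ.* stirling n p)       ≡⟨ -1*i≡-i (+ (p ! ℕ.* stirling n p)) ⟩
    - + (p ! ℕ.* stirling n p)           ≡⟨ cong (-_ ∘ +_) (ℕ.*-assoc p (q !) (stirling n p)) ⟩
    - + (p ℕ.* (q ! ℕ.* stirling n p))   ≡⟨ cong -_ (pos-* p (q ! ℕ.* stirling n p)) ⟩
    - (+ p * + (q ! ℕ.* stirling n p))   ∎
    where open ≡-Reasoning

  lhs[p,1]-p≡ : lhs p 1 - + p ≡ - (+ p * (+ (q !) + 1ℤ))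
  lhs[p,1]-p≡ = begin
    lhs p 1 - + p
      ≡⟨ cong (_- + p) (trans (lhs-closed-form q 0 q≥1) (signedStirling[n,p] p)) ⟩
    - (+ p * + (q ! ℕ.* stirling p p)) - + p
      ≡⟨ cong (λ s → - (+ p * + (q ! ℕ.* s)) - + p) (stirling-diag p) ⟩
    - (+ p * + (q ! ℕ.* 1)) - + p
      ≡⟨ cong (λ m → - (+ p * + m) - + p) (ℕ.*-identityʳ (q !)) ⟩
    - (+ p * + (q !)) - + p
      ≡⟨ factor (+ p) (+ (q !)) ⟩
    - (+ p * (+ (q !) + 1ℤ)) ∎
    where
    open ≡-Reasoning
    factor : ∀ P F → - (P * F) - P ≡ - (P * (F + 1ℤ))
    factor = solve-∀

  open ≡-mod-Reasoning p

  pC[k+1]≡0 : ∀ {k} → k ℕ.< q → + (p C suc k) ≡ 0ℤ mod p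
  pC[k+1]≡0 k<q = ∣⇒≡0-mod (∣ᵤ⇒∣ (prime∣pC[k+1] p-prime k<q))

  -- Since C(q, k) + C(q, k+1) = C(p, k+1) ≡ 0, the binomial coefficient C(q, k) is ≡ (-1)^k.
  qCk*sgn[q+k]≡1 : ∀ k → k ℕ.≤ q → + (q C k) * sgn (q ℕ.+ k) ≡ 1ℤ mod p
  qCk*sgn[q+k]≡1 zero    _   =
    ≡⇒≡-mod (trans (*-identityˡ _) (trans (cong sgn (ℕ.+-identityʳ q)) q-even))
  qCk*sgn[q+k]≡1 (suc k) k<q = begin
    + (q C suc k) * sgn (q ℕ.+ suc k)   ≡⟨ cong (λ e → + (q C suc k) * sgn e) (ℕ.+-suc q k) ⟩
    b * - s                             ≡⟨ rearrange a b s ⟩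
    a * s - (a + b) * s                 ≡⟨ cong (λ c → a * s - c * s) pascal ⟩
    a * s - + (p C suc k) * s
      ≈⟨ +-cong-mod (≡-mod-refl {a = a * s}) (-‿cong-mod (*-congʳ-mod s (pC[k+1]≡0 k<q))) ⟩
    a * s - 0ℤ                          ≡⟨ +-identityʳ (a * s) ⟩
    a * s                               ≈⟨ qCk*sgn[q+k]≡1 k (ℕ.<⇒≤ k<q) ⟩
    1ℤ                                  ∎
    where
    a b s : ℤ
    a = + (q C k)
    b = + (q C suc k)
    s = sgn (q ℕ.+ k)
    rearrange : ∀ a b s → b * - s ≡ a * s - (a + b) * s
    rearrange = solve-∀
    pascal : a + b ≡ + (p C suc k)
    pascal = trans (sym (pos-+ (q C k) (q C suc k))) (cong +_ (nCk+nC[k+1]≡[n+1]C[k+1] q k))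

  Δ[q]f≡sum : ∀ (f : ℕ → ℤ) x → Δ q f x ≡ sumℤ p (λ j → f (x ℕ.+ j)) mod p
  Δ[q]f≡sum f x = begin
    Δ q f x
      ≡⟨ Δ-binomial q f x ⟩
    sumℤ p (λ j → + (q C j) * (sgn (q ℕ.+ j) * f (x ℕ.+ j)))
      ≈⟨ sumℤ-cong-mod p coefficient≡1 ⟩
    sumℤ p (λ j → f (x ℕ.+ j)) ∎
    where
    coefficient≡1 : ∀ j → j ℕ.< p →
      + (q C j) * (sgn (q ℕ.+ j) * f (x ℕ.+ j)) ≡ f (x ℕ.+ j) mod p
    coefficient≡1 j (s≤s j≤q) = begin
      + (q C j) * (sgn (q ℕ.+ j) * f (x ℕ.+ j))
        ≡⟨ *-assoc (+ (q C j)) (sgn (q ℕ.+ j)) (f (x ℕ.+ j)) ⟨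
      + (q C j) * sgn (q ℕ.+ j) * f (x ℕ.+ j)
        ≈⟨ *-congʳ-mod (f (x ℕ.+ j)) (qCk*sgn[q+k]≡1 j j≤q) ⟩
      1ℤ * f (x ℕ.+ j)
        ≡⟨ *-identityˡ (f (x ℕ.+ j)) ⟩
      f (x ℕ.+ j) ∎

  Δ[p]f≡f[x+p]-f[x] : ∀ (f : ℕ → ℤ) x → Δ p f x ≡ f (x ℕ.+ p) - f x mod p
  Δ[p]f≡f[x+p]-f[x] f x = begin
    Δ q f (suc x) - Δ q f x
      ≈⟨ +-cong-mod (Δ[q]f≡sum f (suc x)) (-‿cong-mod (Δ[q]f≡sum f x)) ⟩
    sumℤ p (λ j → f (suc x ℕ.+ j)) - sumℤ p (λ j → f (x ℕ.+ j))
      ≡⟨ cong (_- sumℤ p (λ j → f (x ℕ.+ j)))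
              (sumℤ-cong p (λ j → cong f (sym (ℕ.+-suc x j)))) ⟩
    sumℤ p (λ j → f (x ℕ.+ suc j)) - sumℤ p (λ j → f (x ℕ.+ j))
      ≡⟨ sumℤ-shift p (λ j → f (x ℕ.+ j)) ⟩
    f (x ℕ.+ p) - f (x ℕ.+ 0)
      ≡⟨ cong (λ y → f (x ℕ.+ p) - f y) (ℕ.+-identityʳ x) ⟩
    f (x ℕ.+ p) - f x ∎

  -- The p-th difference of y ↦ c^y is (c - 1)^p, so (c - 1)^p ≡ c^p - 1.
  fermat : ∀ a → (+ a) ^ p ≡ + a mod p
  fermat zero    = ≡-mod-refl
  fermat (suc a) = begin
    c ^ p                  ≡⟨ add-subtract (c ^ p) ⟩
    (c ^ p - c ^ 0) + 1ℤ   ≈⟨ +-cong-mod (≡-mod-sym (Δ[p]f≡f[x+p]-f[x] (c ^_) 0)) ≡-mod-refl ⟩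
    Δ p (c ^_) 0 + 1ℤ      ≡⟨ cong (_+ 1ℤ) Δ[p]c^y≡a^p ⟩
    (+ a) ^ p + 1ℤ         ≈⟨ +-cong-mod (fermat a) ≡-mod-refl ⟩
    + a + 1ℤ               ≡⟨ trans (+-comm (+ a) 1ℤ) (sym (pos-+ 1 a)) ⟩
    c                      ∎
    where
    c : ℤ
    c = + suc a
    add-subtract : ∀ x → x ≡ (x - 1ℤ) + 1ℤ
    add-subtract = solve-∀
    cancel : ∀ x → (1ℤ + x) - 1ℤ ≡ x
    cancel = solve-∀
    c-1≡a : c - 1ℤ ≡ + a
    c-1≡a = trans (cong (_- 1ℤ) (pos-+ 1 a)) (cancel (+ a))
    Δ[p]c^y≡a^p : Δ p (c ^_) 0 ≡ (+ a) ^ p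
    Δ[p]c^y≡a^p = trans (Δ-geometric p c 0)
      (trans (*-identityʳ ((c - 1ℤ) ^ p)) (cong (_^ p) c-1≡a))

  fermat-unit : ∀ a → a ℕ.< q → (+ suc a) ^ q ≡ 1ℤ mod p
  fermat-unit a a<q = cancel-mod p-prime (>⇒∤ (s≤s a<q)) (begin
    (+ suc a) ^ p   ≈⟨ fermat (suc a) ⟩
    + suc a         ≡⟨ *-identityʳ (+ suc a) ⟨
    + suc a * 1ℤ    ∎)

  powerSum : ℕ → ℤ
  powerSum n = sumℤ p (λ j → (+ j) ^ n)

  q!*stirling≡powerSum : ∀ n → + (q ! ℕ.* stirling n q) ≡ powerSum n mod p
  q!*stirling≡powerSum n = begin
    + (q ! ℕ.* stirling n q)    ≡⟨ Δ-pow n q ⟨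
    Δ q (λ y → (+ y) ^ n) 0     ≈⟨ Δ[q]f≡sum (λ y → (+ y) ^ n) 0 ⟩
    powerSum n                  ∎

  wilson : + (q !) ≡ -1ℤ mod p
  wilson = begin
    + (q !)                                    ≡⟨ cong +_ q!≡q!*stirling[q,q] ⟩
    + (q ! ℕ.* stirling q q)                   ≈⟨ q!*stirling≡powerSum q ⟩
    (+ 0) ^ q + sumℤ q (λ j → (+ suc j) ^ q)
      ≈⟨ +-cong-mod (≡⇒≡-mod (0^n≡0 q≥1)) (sumℤ-cong-mod q fermat-unit) ⟩
    0ℤ + sumℤ q (λ _ → 1ℤ)                     ≡⟨ trans (+-identityˡ _) (sumℤ-ones q) ⟩
    + q                                        ≈⟨ congruent (divides 1ℤ q+1≡p) ⟩
    -1ℤ                                        ∎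
    where
    q!≡q!*stirling[q,q] : q ! ≡ q ! ℕ.* stirling q q
    q!≡q!*stirling[q,q] = sym (trans (cong (q ! ℕ.*_) (stirling-diag q)) (ℕ.*-identityʳ (q !)))
    q+1≡p : + q - -1ℤ ≡ 1ℤ * + p
    q+1≡p = trans (sym (pos-+ q 1)) (trans (cong +_ (ℕ.+-comm q 1)) (sym (*-identityˡ (+ p))))

  pow-periodic : ∀ a n → (+ a) ^ (suc n ℕ.+ q) ≡ (+ a) ^ suc n mod p
  pow-periodic a n = begin
    (+ a) ^ (suc n ℕ.+ q)      ≡⟨ cong ((+ a) ^_) (ℕ.+-suc n q) ⟨
    (+ a) ^ (n ℕ.+ p)          ≡⟨ ^-distribˡ-+-* (+ a) n p ⟩
    (+ a) ^ n * (+ a) ^ p      ≈⟨ *-congˡ-mod ((+ a) ^ n) (fermat a) ⟩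
    (+ a) ^ n * + a            ≡⟨ *-comm ((+ a) ^ n) (+ a) ⟩
    (+ a) ^ suc n              ∎

  q!*stirling-periodic : ∀ n →
    + (q ! ℕ.* stirling (suc n ℕ.+ q) q) ≡ + (q ! ℕ.* stirling (suc n) q) mod p
  q!*stirling-periodic n = begin
    + (q ! ℕ.* stirling (suc n ℕ.+ q) q)   ≈⟨ q!*stirling≡powerSum (suc n ℕ.+ q) ⟩
    powerSum (suc n ℕ.+ q)                 ≈⟨ sumℤ-cong-mod p (λ a _ → pow-periodic a n) ⟩
    powerSum (suc n)                       ≈⟨ ≡-mod-sym (q!*stirling≡powerSum (suc n)) ⟩
    + (q ! ℕ.* stirling (suc n) q)         ∎

  q!*stirling[n+p,p]≡0 : ∀ n → suc n ℕ.< q → + (q ! ℕ.* stirling (suc n ℕ.+ p) p) ≡ 0ℤ mod p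
  q!*stirling[n+p,p]≡0 n n<q = begin
    + (q ! ℕ.* (p ℕ.* X ℕ.+ Y))             ≡⟨ cong +_ (regroup (q !) p X Y) ⟩
    + ((q ! ℕ.* X) ℕ.* p ℕ.+ q ! ℕ.* Y)     ≡⟨ pos-+ ((q ! ℕ.* X) ℕ.* p) (q ! ℕ.* Y) ⟩
    + ((q ! ℕ.* X) ℕ.* p) + + (q ! ℕ.* Y)
      ≈⟨ +-cong-mod multiple≡0 (≡-mod-refl {a = + (q ! ℕ.* Y)}) ⟩
    0ℤ + + (q ! ℕ.* Y)                      ≡⟨ +-identityˡ _ ⟩
    + (q ! ℕ.* stirling (n ℕ.+ p) q)
      ≡⟨ cong (λ m → + (q ! ℕ.* stirling m q)) (ℕ.+-suc n q) ⟩
    + (q ! ℕ.* stirling (suc n ℕ.+ q) q)    ≈⟨ q!*stirling-periodic n ⟩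
    + (q ! ℕ.* stirling (suc n) q)          ≡⟨ cong (λ s → + (q ! ℕ.* s)) (stirling-< _ _ n<q) ⟩
    + (q ! ℕ.* 0)                           ≡⟨ cong +_ (ℕ.*-zeroʳ (q !)) ⟩
    0ℤ                                      ∎
    where
    X Y : ℕ
    X = stirling (n ℕ.+ p) p
    Y = stirling (n ℕ.+ p) q
    regroup : ∀ f p x y → f ℕ.* (p ℕ.* x ℕ.+ y) ≡ (f ℕ.* x) ℕ.* p ℕ.+ f ℕ.* y
    regroup = ℕ-Solver.solve-∀
    multiple≡0 : + ((q ! ℕ.* X) ℕ.* p) ≡ 0ℤ mod p
    multiple≡0 = ∣⇒≡0-mod (divides (+ (q ! ℕ.* X)) (pos-* (q ! ℕ.* X) p))

  p²∣lhs[p,1]-p : + (p ℕ.^ 2) Unsigned.∣ lhs p 1 - + p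
  p²∣lhs[p,1]-p = subst (+ (p ℕ.^ 2) Unsigned.∣_) (sym lhs[p,1]-p≡)
    (≡0-mod⇒m²∣-m*a (+-cong-mod wilson (≡-mod-refl {a = 1ℤ})))

  p²∣lhs[p,2+i] : ∀ i → suc (suc i) ℕ.≤ q → + (p ℕ.^ 2) Unsigned.∣ lhs p (suc (suc i))
  p²∣lhs[p,2+i] i i+2≤q = subst (+ (p ℕ.^ 2) Unsigned.∣_)
    (sym (trans (lhs-closed-form q (suc i) i+2≤q) (signedStirling[n,p] (suc i ℕ.+ p))))
    (≡0-mod⇒m²∣-m*a (q!*stirling[n+p,p]≡0 i i+2≤q))

open import Data.Nat as ℕ using (zero; s≤s; _≤_; _∸_; _^_)
import Data.Nat.Properties as ℕ
import Data.Nat.Divisibility as ℕ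
open import Data.Nat.Primality using (prime⇒irreducible)
open import Data.Integer using (+_; _-_; -_; -1ℤ)
open import Data.Integer.Divisibility using (_∣_)
open import Data.Product using (_×_; _,_)
open import Data.Sum using (_⊎_; inj₁; inj₂)
open import Relation.Binary.PropositionalEquality using (refl; cong; subst)
open import Relation.Nullary using (contradiction)

sgn-parity : ∀ n → (sgn n ≡ 1ℤ × 2 ℕ.∣ n) ⊎ (sgn n ≡ -1ℤ × 2 ℕ.∣ suc n)
sgn-parity zero    = inj₁ (refl , 2 ℕ.∣0)
sgn-parity (suc n) with sgn-parity n
... | inj₁ (sgn≡1 , 2∣n)    =
  inj₂ (cong -_ sgn≡1 , subst (2 ℕ.∣_) (ℕ.+-comm n 2) (ℕ.∣m∣n⇒∣m+n 2∣n ℕ.∣-refl))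
... | inj₂ (sgn≡-1 , 2∣1+n) = inj₁ (cong -_ sgn≡-1 , 2∣1+n)

odd-prime⇒sgn[p-1]≡1 : ∀ {q} → Prime (suc q) → 2 ≤ q → sgn q ≡ 1ℤ
odd-prime⇒sgn[p-1]≡1 {q} p-prime 2≤q with sgn-parity q
... | inj₁ (sgn≡1 , _) = sgn≡1
... | inj₂ (_ , 2∣p) with prime⇒irreducible p-prime 2∣p
...   | inj₁ ()
...   | inj₂ 2≡p = contradiction 2≡p (ℕ.<⇒≢ (s≤s 2≤q))

lemma2p3 : (p i : ℕ) → Prime p → 3 ≤ p → 1 ≤ i → i ≤ p ∸ 1 →
    (i ≡ 1 → (+ (p ^ 2)) ∣ (lhs p i - + p)) × (2 ≤ i → (+ (p ^ 2)) ∣ lhs p i)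
lemma2p3 (suc q) (suc zero)    p-prime (s≤s 2≤q) _ _     = (λ _ → p²∣lhs[p,1]-p) , λ { (s≤s ()) }
  where open OddPrime p-prime (odd-prime⇒sgn[p-1]≡1 p-prime 2≤q)
lemma2p3 (suc q) (suc (suc i)) p-prime (s≤s 2≤q) _ i+2≤q = (λ ()) , λ _ → p²∣lhs[p,2+i] i i+2≤q
  where open OddPrime p-prime (odd-prime⇒sgn[p-1]≡1 p-prime 2≤q)
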